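{- Let $\mathcal{L}$ be a unimodal signature and let $(\Delta_\alpha,\nabla_\beta)$ be one of the twelve labelled pairs listed in the context with $\Delta_\alpha,\nabla_\beta\in\mathcal{L}$. Then for every $\mathcal{L}$-modal frame $\mathcal{F}$: $\mathcal{F}$ satisfies the frame condition $(\Delta_\alpha,\nabla_\beta)$ if and only if its complex algebra $\mathcal{F}^{+}$ satisfies the quasiequation $(\Delta_\alpha,\nabla_\beta)$ (for all elements $a,b,c$).
   Context: All distributive lattices are bounded. Modal symbols: $\Box_{+},\Box_{ - },\Diamond_{+},\Diamond_{ - }$; a unimodal signature $\mathcal{L}$ is a subset of these. An $\mathcal{L}$-modal algebra is a bounded distributive lattice with one unary operation per symbol in $\mathcal{L}$ satisfying the applicable identities $\Box_{+}(a\wedge b)=\Box_{+}a\wedge\Box_{+}b$, $\Box_{+}\top=\top$; $\Box_{ - }(a\vee b)=\Box_{ - }a\wedge\Box_{ - }b$, $\Box_{ - }\bot=\top$; $\Diamond_{+}(a\vee b)=\Diamond_{+}a\vee\Diamond_{+}b$, $\Diamond_{+}\bot=\bot$; $\Diamond_{ - }(a\wedge b)=\Diamond_{ - }a\vee\Diamond_{ - }b$, $\Diamond_{ - }\top=\bot$. For relations $S,T$, $x\,(S\circ T)\,z$ iff $xSy$ and $yTz$ for some $y$. On a poset $(W,\leq)$, $R\subseteq W\times W$ is a $\Box_{+}$-relation if ${\leq}\circ R\circ{\leq}\subseteq R$, a $\Box_{ - }$-relation if ${\leq}\circ R\circ{\geq}\subseteq R$, a $\Diamond_{+}$-relation if ${\geq}\circ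 R\circ{\geq}\subseteq R$, a $\Diamond_{ - }$-relation if ${\geq}\circ R\circ{\leq}\subseteq R$. An $\mathcal{L}$-modal frame is a poset $(W,\leq)$ with a $\Delta_\alpha$-relation $R^{\Delta}_{\alpha}$ for each $\Delta_\alpha\in\mathcal{L}$. Its complex algebra $\mathcal{F}^{+}$ is the lattice of upsets of $(W,\leq)$ with $\Box_{+}a=\{u:\forall v\,(uR^{\Box}_{+}v\Rightarrow v\in a)\}$, $\Box_{ - }a=\{u:\forall v\,(uR^{\Box}_{ - }v\Rightarrow v\notin a)\}$, $\Diamond_{+}a=\{u:\exists v\in a,\ uR^{\Diamond}_{+}v\}$, $\Diamond_{ - }a=\{u:\exists v\notin a,\ uR^{\Diamond}_{ - }v\}$. Quasiequations (for all $a,b,c$): $(\Box_{+},\Box_{ - })$: $\Box_{ - }a\wedge\Box_{+}(a\vee b)\leq\Box_{+}b$; $(\Box_{ - },\Box_{+})$: $\Box_{+}a\wedge\Box_{ - }(a\wedge b)\leq\Box_{ - }b$; $(\Diamond_{+},\Diamond_{ - })$: $\Diamond_{+}b\leq\Diamond_{+}(a\wedge b)\vee\Diamond_{ - }a$; $(\Diamond_{ - },\Diamond_{+})$: $\Diamond_{ - }b\leq\Diamond_{ - }(a\vee b)\vee\Diamond_{+}a$; $(\Box_{+},\Diamond_{ - })$: $\Diamond_{ - }a\wedge c\leq\Box_{+}a\Rightarrow c\leq\Box_{+}a$; $(\Box_{ - },\Diamond_{+})$: $\Diamond_{+}a\wedge c\leq\Box_{ - }a\Rightarrow c\leq\Box_{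 - }a$; $(\Diamond_{+},\Box_{ - })$: $\Diamond_{+}a\leq\Box_{ - }a\vee c\Rightarrow\Diamond_{+}a\leq c$; $(\Diamond_{ - },\Box_{+})$: $\Diamond_{ - }a\leq\Box_{+}a\vee c\Rightarrow\Diamond_{ - }a\leq c$; $(\Box_{+},\Diamond_{+})$: $\Diamond_{+}b\wedge c\leq\Box_{+}a\Rightarrow\Box_{+}(a\vee b)\wedge c\leq\Box_{+}a$; $(\Box_{ - },\Diamond_{ - })$: $\Diamond_{ - }b\wedge c\leq\Box_{ - }a\Rightarrow\Box_{ - }(a\wedge b)\wedge c\leq\Box_{ - }a$; $(\Diamond_{+},\Box_{+})$: $\Diamond_{+}a\leq\Box_{+}b\vee c\Rightarrow\Diamond_{+}a\leq\Diamond_{+}(a\wedge b)\vee c$; $(\Diamond_{ - },\Box_{ - })$: $\Diamond_{ - }a\leq\Box_{ - }b\vee c\Rightarrow\Diamond_{ - }a\leq\Diamond_{ - }(a\vee b)\vee c$. Frame conditions: $(\Box_{+},\Box_{ - })$: $R^{\Box}_{+}\subseteq(R^{\Box}_{+}\cap R^{\Box}_{ - })\circ{\leq}$; $(\Box_{ - },\Box_{+})$: $R^{\Box}_{ - }\subseteq(R^{\Box}_{ - }\cap R^{\Box}_{+})\circ{\geq}$; $(\Diamond_{+},\Diamond_{ - })$: $R^{\Diamond}_{+}\subseteq(R^{\Diamond}_{+}\cap R^{\Diamond}_{ - })\circ{\geq}$; $(\Diamond_{ - },\Diamond_{+})$: $R^{\Diamond}_{ - }\subseteq(R^{\Diamond}_{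 - }\cap R^{\Diamond}_{+})\circ{\leq}$; $(\Box_{+},\Diamond_{ - })$: $R^{\Box}_{+}\subseteq{\leq}\circ(R^{\Box}_{+}\cap R^{\Diamond}_{ - })$; $(\Box_{ - },\Diamond_{+})$: $R^{\Box}_{ - }\subseteq{\leq}\circ(R^{\Box}_{ - }\cap R^{\Diamond}_{+})$; $(\Diamond_{+},\Box_{ - })$: $R^{\Diamond}_{+}\subseteq{\geq}\circ(R^{\Diamond}_{+}\cap R^{\Box}_{ - })$; $(\Diamond_{ - },\Box_{+})$: $R^{\Diamond}_{ - }\subseteq{\geq}\circ(R^{\Diamond}_{ - }\cap R^{\Box}_{+})$; $(\Box_{+},\Diamond_{+})$: if $uR^{\Box}_{+}v$ then there are $u'\geq u$, $v'\leq v$ with $u'R^{\Box}_{+}v$, $uR^{\Box}_{+}v'$, $u'R^{\Diamond}_{+}v'$; $(\Box_{ - },\Diamond_{ - })$: if $uR^{\Box}_{ - }v$ then there are $u'\geq u$, $v'\geq v$ with $u'R^{\Box}_{ - }v$, $uR^{\Box}_{ - }v'$, $u'R^{\Diamond}_{ - }v'$; $(\Diamond_{+},\Box_{+})$: if $uR^{\Diamond}_{+}v$ then there are $u'\leq u$, $v'\geq v$ with $u'R^{\Diamond}_{+}v$, $uR^{\Diamond}_{+}v'$, $u'R^{\Box}_{+}v'$; $(\Diamond_{ - },\Box_{ - })$: if $uR^{\Diamond}_{ - }v$ then there are $u'\leq u$, $v'\leq v$ with $u'R^{\Diamond}_{ - }v$, $uR^{\Diamond}_{ - }v'$, $u'R^{\Box}_{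 - }v'$. -}

module Defs where

open import Level using (0ℓ)
open import Data.Bool using (Bool; T)
open import Data.Product using (Σ; ∃; ∃-syntax; _×_; _,_)
open import Data.Sum using (_⊎_)
open import Relation.Nullary using (¬_)
open import Relation.Binary.PropositionalEquality using (_≡_)
open import Relation.Binary.Structures using (IsPartialOrder)

data Sym : Set where
  □+ □- ◇+ ◇- : Sym

Signature : Set
Signature = Sym → Bool

_∈ˢ_ : Sym → Signature → Set
s ∈ˢ 𝓛 = T (𝓛 s)

module _ {W : Set} (_≤_ : W → W → Set) where

  -- the Δ-relation conditions  (≤∘R∘≤ ⊆ R etc.), written pointwise
  IsSymRel : Sym → (W → W → Set) → Set
  IsSymRel □+ R = ∀ {x y z w} → x ≤ y → R y z → z ≤ w → R x w
  IsSymRel □- R = ∀ {x y z w} → x ≤ y → R y z → w ≤ z → R x w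
  IsSymRel ◇+ R = ∀ {x y z w} → y ≤ x → R y z → w ≤ z → R x w
  IsSymRel ◇- R = ∀ {x y z w} → y ≤ x → R y z → z ≤ w → R x w

record Frame (𝓛 : Signature) : Set₁ where
  field
    W              : Set
    _≤_            : W → W → Set
    isPartialOrder : IsPartialOrder _≡_ _≤_
    R              : (s : Sym) → s ∈ˢ 𝓛 → W → W → Set
    isSymRel       : (s : Sym) (p : s ∈ˢ 𝓛) → IsSymRel _≤_ s (R s p)

data Pair : Set where
  [□+,□-] [□-,□+] [◇+,◇-] [◇-,◇+] : Pair
  [□+,◇-] [□-,◇+] [◇+,□-] [◇-,□+] : Pair
  [□+,◇+] [□-,◇-] [◇+,□+] [◇-,□-] : Pair

first second : Pair → Sym
first [□+,□-] = □+
first [□-,□+] = □-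
first [◇+,◇-] = ◇+
first [◇-,◇+] = ◇-
first [□+,◇-] = □+
first [□-,◇+] = □-
first [◇+,□-] = ◇+
first [◇-,□+] = ◇-
first [□+,◇+] = □+
first [□-,◇-] = □-
first [◇+,□+] = ◇+
first [◇-,□-] = ◇-
second [□+,□-] = □-
second [□-,□+] = □+
second [◇+,◇-] = ◇-
second [◇-,◇+] = ◇+
second [□+,◇-] = ◇-
second [□-,◇+] = ◇+
second [◇+,□-] = □-
second [◇-,□+] = □+
second [□+,◇+] = ◇+
second [□-,◇-] = ◇-
second [◇+,□+] = □+
second [◇-,□-] = □-

module ComplexAlgebra {𝓛 : Signature} (F : Frame 𝓛) where
  open Frame F

  record Upset : Set₁ where
    constructor upset
    field
      mem  : W → Set
      up   : ∀ {u v} → u ≤ v → mem u → mem v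
  open Upset public

  Pred : Set₁
  Pred = W → Set

  _⊆_ : Pred → Pred → Set
  P ⊆ Q = ∀ u → P u → Q u

  _∩_ : Pred → Pred → Pred
  (P ∩ Q) u = P u × Q u

  _∪_ : Pred → Pred → Pred
  (P ∪ Q) u = P u ⊎ Q u

  infix  4 _⊆_
  infixr 7 _∩_
  infixr 6 _∪_

  op : (s : Sym) → s ∈ˢ 𝓛 → Pred → Pred
  op □+ p a u = ∀ v → R □+ p u v → a v
  op □- p a u = ∀ v → R □- p u v → ¬ a v
  op ◇+ p a u = ∃[ v ] (a v × R ◇+ p u v)
  op ◇- p a u = ∃[ v ] (¬ a v × R ◇- p u v)

  Quasi : (π : Pair) → first π ∈ˢ 𝓛 → second π ∈ˢ 𝓛 → Set₁
  Quasi [□+,□-] p q = ∀ (a b c : Upset) →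
    op □- q (mem a) ∩ op □+ p (mem a ∪ mem b) ⊆ op □+ p (mem b)
  Quasi [□-,□+] p q = ∀ (a b c : Upset) →
    op □+ q (mem a) ∩ op □- p (mem a ∩ mem b) ⊆ op □- p (mem b)
  Quasi [◇+,◇-] p q = ∀ (a b c : Upset) →
    op ◇+ p (mem b) ⊆ op ◇+ p (mem a ∩ mem b) ∪ op ◇- q (mem a)
  Quasi [◇-,◇+] p q = ∀ (a b c : Upset) →
    op ◇- p (mem b) ⊆ op ◇- p (mem a ∪ mem b) ∪ op ◇+ q (mem a)
  Quasi [□+,◇-] p q = ∀ (a b c : Upset) →
    op ◇- q (mem a) ∩ mem c ⊆ op □+ p (mem a) → mem c ⊆ op □+ p (mem a)
  Quasi [□-,◇+] p q = ∀ (a b c : Upset) →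
    op ◇+ q (mem a) ∩ mem c ⊆ op □- p (mem a) → mem c ⊆ op □- p (mem a)
  Quasi [◇+,□-] p q = ∀ (a b c : Upset) →
    op ◇+ p (mem a) ⊆ op □- q (mem a) ∪ mem c → op ◇+ p (mem a) ⊆ mem c
  Quasi [◇-,□+] p q = ∀ (a b c : Upset) →
    op ◇- p (mem a) ⊆ op □+ q (mem a) ∪ mem c → op ◇- p (mem a) ⊆ mem c
  Quasi [□+,◇+] p q = ∀ (a b c : Upset) →
    op ◇+ q (mem b) ∩ mem c ⊆ op □+ p (mem a) →
    op □+ p (mem a ∪ mem b) ∩ mem c ⊆ op □+ p (mem a)
  Quasi [□-,◇-] p q = ∀ (a b c : Upset) →
    op ◇- q (mem b) ∩ mem c ⊆ op □- p (mem a) →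
    op □- p (mem a ∩ mem b) ∩ mem c ⊆ op □- p (mem a)
  Quasi [◇+,□+] p q = ∀ (a b c : Upset) →
    op ◇+ p (mem a) ⊆ op □+ q (mem b) ∪ mem c →
    op ◇+ p (mem a) ⊆ op ◇+ p (mem a ∩ mem b) ∪ mem c
  Quasi [◇-,□-] p q = ∀ (a b c : Upset) →
    op ◇- p (mem a) ⊆ op □- q (mem b) ∪ mem c →
    op ◇- p (mem a) ⊆ op ◇- p (mem a ∪ mem b) ∪ mem c

module _ {𝓛 : Signature} (F : Frame 𝓛) where
  open Frame F

  FrameCond : (π : Pair) → first π ∈ˢ 𝓛 → second π ∈ˢ 𝓛 → Set
  FrameCond [□+,□-] p q = ∀ u v → R □+ p u v →
    ∃[ w ] ((R □+ p u w × R □- q u w) × w ≤ v)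
  FrameCond [□-,□+] p q = ∀ u v → R □- p u v →
    ∃[ w ] ((R □- p u w × R □+ q u w) × v ≤ w)
  FrameCond [◇+,◇-] p q = ∀ u v → R ◇+ p u v →
    ∃[ w ] ((R ◇+ p u w × R ◇- q u w) × v ≤ w)
  FrameCond [◇-,◇+] p q = ∀ u v → R ◇- p u v →
    ∃[ w ] ((R ◇- p u w × R ◇+ q u w) × w ≤ v)
  FrameCond [□+,◇-] p q = ∀ u v → R □+ p u v →
    ∃[ w ] (u ≤ w × (R □+ p w v × R ◇- q w v))
  FrameCond [□-,◇+] p q = ∀ u v → R □- p u v →
    ∃[ w ] (u ≤ w × (R □- p w v × R ◇+ q w v))
  FrameCond [◇+,□-] p q = ∀ u v → R ◇+ p u v →
    ∃[ w ] (w ≤ u × (R ◇+ p w v × R □- q w v))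
  FrameCond [◇-,□+] p q = ∀ u v → R ◇- p u v →
    ∃[ w ] (w ≤ u × (R ◇- p w v × R □+ q w v))
  FrameCond [□+,◇+] p q = ∀ u v → R □+ p u v →
    ∃[ u' ] ∃[ v' ] (u ≤ u' × v' ≤ v ×
      R □+ p u' v × R □+ p u v' × R ◇+ q u' v')
  FrameCond [□-,◇-] p q = ∀ u v → R □- p u v →
    ∃[ u' ] ∃[ v' ] (u ≤ u' × v ≤ v' ×
      R □- p u' v × R □- p u v' × R ◇- q u' v')
  FrameCond [◇+,□+] p q = ∀ u v → R ◇+ p u v →
    ∃[ u' ] ∃[ v' ] (u' ≤ u × v ≤ v' ×
      R ◇+ p u' v × R ◇+ p u v' × R □+ q u' v')
  FrameCond [◇-,□-] p q = ∀ u v → R ◇- p u v →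
    ∃[ u' ] ∃[ v' ] (u' ≤ u × v' ≤ v ×
      R ◇- p u' v × R ◇- p u v' × R □- q u' v')

-- Frame condition ⇒ quasiequation is a direct unfolding: the witnesses
-- supplied by the frame condition are exactly the points at which the
-- premise of the quasiequation is applied.  Conversely, if the frame
-- condition fails at a pair u R v, instantiate the quasiequation with
-- upsets that single out this failure: the principal upset ↑ v, the
-- complement ∁↓ v of the principal downset, and the (non-)successor sets
-- of u, which are upsets because R is a Δ-relation.  The failure makes the
-- premise hold, while the conclusion is refuted at u (or at v) itself.

module Submission where

open import Defs
open import Level using (0ℓ)
open import Axiom.ExcludedMiddle using (ExcludedMiddle)
open import Axiom.DoubleNegationElimination using (em⇒dne)
open import Function.Bundles using (_⇔_; mk⇔)
open import Data.Product using (∃-syntax; _×_; _,_)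
open import Data.Sum using (inj₁; inj₂; [_,_]′)
open import Relation.Nullary using (¬_; contradiction)
open import Relation.Nullary.Decidable using (toSum)
open import Relation.Binary.Structures using (IsPartialOrder)

module _ {𝓛 : Signature} (F : Frame 𝓛) where
  open Frame F
  open ComplexAlgebra F
  open IsPartialOrder isPartialOrder using ()
    renaming (refl to ≤-refl; trans to ≤-trans)

  successorUpset : {S : W → W → Set} →
    (∀ {u v w} → S u v → v ≤ w → S u w) → W → Upset
  successorUpset {S} monoʳ u = upset (S u) (λ v≤w uSv → monoʳ {u} uSv v≤w)

  nonSuccessorUpset : {S : W → W → Set} →
    (∀ {u v w} → S u w → v ≤ w → S u v) → W → Upset
  nonSuccessorUpset {S} antimonoʳ u =
    upset (λ v → ¬ S u v) (λ v≤w ¬uSv uSw → ¬uSv (antimonoʳ {u} uSw v≤w))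

  ↑_ : W → Upset
  ↑_ = successorUpset {_≤_} ≤-trans

  ∁↓_ : W → Upset
  ∁↓_ = nonSuccessorUpset {λ u v → v ≤ u} (λ w≤u v≤w → ≤-trans v≤w w≤u)

  ∉∁↓-self : ∀ {v} → ¬ mem (∁↓ v) v
  ∉∁↓-self ¬v≤v = ¬v≤v ≤-refl

  □+-monoʳ : (p : □+ ∈ˢ 𝓛) → ∀ {u v w} → R □+ p u v → v ≤ w → R □+ p u w
  □+-monoʳ p = isSymRel □+ p ≤-refl

  ◇--monoʳ : (p : ◇- ∈ˢ 𝓛) → ∀ {u v w} → R ◇- p u v → v ≤ w → R ◇- p u w
  ◇--monoʳ p = isSymRel ◇- p ≤-refl

  □--antimonoʳ : (p : □- ∈ˢ 𝓛) → ∀ {u v w} → R □- p u w → v ≤ w → R □- p u v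
  □--antimonoʳ p = isSymRel □- p ≤-refl

  ◇+-antimonoʳ : (p : ◇+ ∈ˢ 𝓛) → ∀ {u v w} → R ◇+ p u w → v ≤ w → R ◇+ p u v
  ◇+-antimonoʳ p = isSymRel ◇+ p ≤-refl

  frameCond⇒quasi-□+□- : ∀ p q → FrameCond F [□+,□-] p q → Quasi [□+,□-] p q
  frameCond⇒quasi-□+□- p q cond a b _ u (u∈□-a , u∈□+a∪b) v uRv
    with cond u v uRv
  ... | w , (uRw , uR-w) , w≤v =
    [ (λ aw → contradiction aw (u∈□-a w uR-w)) , up b w≤v ]′ (u∈□+a∪b w uRw)

  frameCond⇒quasi-□-□+ : ∀ p q → FrameCond F [□-,□+] p q → Quasi [□-,□+] p q
  frameCond⇒quasi-□-□+ p q cond a b _ u (u∈□+a , u∈□-a∩b) v uRv bv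
    with cond u v uRv
  ... | w , (uRw , uR+w) , v≤w = u∈□-a∩b w uRw (u∈□+a w uR+w , up b v≤w bv)

  frameCond⇒quasi-◇+◇- : ExcludedMiddle 0ℓ →
    ∀ p q → FrameCond F [◇+,◇-] p q → Quasi [◇+,◇-] p q
  frameCond⇒quasi-◇+◇- em p q cond a b _ u (v , bv , uRv)
    with cond u v uRv
  ... | w , (uRw , uR-w) , v≤w with toSum (em {mem a w})
  ...   | inj₁ aw  = inj₁ (w , (aw , up b v≤w bv) , uRw)
  ...   | inj₂ ¬aw = inj₂ (w , ¬aw , uR-w)

  frameCond⇒quasi-◇-◇+ : ExcludedMiddle 0ℓ →
    ∀ p q → FrameCond F [◇-,◇+] p q → Quasi [◇-,◇+] p q
  frameCond⇒quasi-◇-◇+ em p q cond a b _ u (v , ¬bv , uRv)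
    with cond u v uRv
  ... | w , (uRw , uR+w) , w≤v with toSum (em {mem a w})
  ...   | inj₁ aw  = inj₂ (w , aw , uR+w)
  ...   | inj₂ ¬aw =
    inj₁ (w , [ ¬aw , (λ bw → ¬bv (up b w≤v bw)) ]′ , uRw)

  frameCond⇒quasi-□+◇- : ExcludedMiddle 0ℓ →
    ∀ p q → FrameCond F [□+,◇-] p q → Quasi [□+,◇-] p q
  frameCond⇒quasi-□+◇- em p q cond a _ c premise u cu v uRv
    with toSum (em {mem a v})
  ... | inj₁ av = av
  ... | inj₂ ¬av with cond u v uRv
  ...   | w , u≤w , wRv , wR-v =
    contradiction (premise w ((v , ¬av , wR-v) , up c u≤w cu) v wRv) ¬av

  frameCond⇒quasi-□-◇+ : ∀ p q → FrameCond F [□-,◇+] p q → Quasi [□-,◇+] p q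
  frameCond⇒quasi-□-◇+ p q cond a _ c premise u cu v uRv av
    with cond u v uRv
  ... | w , u≤w , wRv , wR+v =
    premise w ((v , av , wR+v) , up c u≤w cu) v wRv av

  frameCond⇒quasi-◇+□- : ∀ p q → FrameCond F [◇+,□-] p q → Quasi [◇+,□-] p q
  frameCond⇒quasi-◇+□- p q cond a _ c premise u (v , av , uRv)
    with cond u v uRv
  ... | w , w≤u , wRv , wR-v =
    [ (λ w∈□-a → contradiction av (w∈□-a v wR-v)) , up c w≤u ]′
      (premise w (v , av , wRv))

  frameCond⇒quasi-◇-□+ : ∀ p q → FrameCond F [◇-,□+] p q → Quasi [◇-,□+] p q
  frameCond⇒quasi-◇-□+ p q cond a _ c premise u (v , ¬av , uRv)
    with cond u v uRv
  ... | w , w≤u , wRv , wR+v =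
    [ (λ w∈□+a → contradiction (w∈□+a v wR+v) ¬av) , up c w≤u ]′
      (premise w (v , ¬av , wRv))

  frameCond⇒quasi-□+◇+ : ∀ p q → FrameCond F [□+,◇+] p q → Quasi [□+,◇+] p q
  frameCond⇒quasi-□+◇+ p q cond a b c premise u (u∈□+a∪b , cu) v uRv
    with cond u v uRv
  ... | u' , v' , u≤u' , v'≤v , u'Rv , uRv' , u'R+v' =
    [ up a v'≤v
    , (λ bv' → premise u' ((v' , bv' , u'R+v') , up c u≤u' cu) v u'Rv) ]′
      (u∈□+a∪b v' uRv')

  frameCond⇒quasi-□-◇- : ExcludedMiddle 0ℓ →
    ∀ p q → FrameCond F [□-,◇-] p q → Quasi [□-,◇-] p q
  frameCond⇒quasi-□-◇- em p q cond a b c premise u (u∈□-a∩b , cu) v uRv av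
    with cond u v uRv
  ... | u' , v' , u≤u' , v≤v' , u'Rv , uRv' , u'R-v' with toSum (em {mem b v'})
  ...   | inj₁ bv'  = u∈□-a∩b v' uRv' (up a v≤v' av , bv')
  ...   | inj₂ ¬bv' = premise u' ((v' , ¬bv' , u'R-v') , up c u≤u' cu) v u'Rv av

  frameCond⇒quasi-◇+□+ : ∀ p q → FrameCond F [◇+,□+] p q → Quasi [◇+,□+] p q
  frameCond⇒quasi-◇+□+ p q cond a b c premise u (v , av , uRv)
    with cond u v uRv
  ... | u' , v' , u'≤u , v≤v' , u'Rv , uRv' , u'R+v' =
    [ (λ u'∈□+b → inj₁ (v' , (up a v≤v' av , u'∈□+b v' u'R+v') , uRv'))
    , (λ cu' → inj₂ (up c u'≤u cu')) ]′
      (premise u' (v , av , u'Rv))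

  frameCond⇒quasi-◇-□- : ∀ p q → FrameCond F [◇-,□-] p q → Quasi [◇-,□-] p q
  frameCond⇒quasi-◇-□- p q cond a b c premise u (v , ¬av , uRv)
    with cond u v uRv
  ... | u' , v' , u'≤u , v'≤v , u'Rv , uRv' , u'R-v' =
    [ (λ u'∈□-b → inj₁ (v' , [ (λ av' → ¬av (up a v'≤v av')) , u'∈□-b v' u'R-v' ]′
                            , uRv'))
    , (λ cu' → inj₂ (up c u'≤u cu')) ]′
      (premise u' (v , ¬av , u'Rv))

  frameCond⇒quasi : ExcludedMiddle 0ℓ →
    ∀ π p q → FrameCond F π p q → Quasi π p q
  frameCond⇒quasi em [□+,□-] = frameCond⇒quasi-□+□-
  frameCond⇒quasi em [□-,□+] = frameCond⇒quasi-□-□+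
  frameCond⇒quasi em [◇+,◇-] = frameCond⇒quasi-◇+◇- em
  frameCond⇒quasi em [◇-,◇+] = frameCond⇒quasi-◇-◇+ em
  frameCond⇒quasi em [□+,◇-] = frameCond⇒quasi-□+◇- em
  frameCond⇒quasi em [□-,◇+] = frameCond⇒quasi-□-◇+
  frameCond⇒quasi em [◇+,□-] = frameCond⇒quasi-◇+□-
  frameCond⇒quasi em [◇-,□+] = frameCond⇒quasi-◇-□+
  frameCond⇒quasi em [□+,◇+] = frameCond⇒quasi-□+◇+
  frameCond⇒quasi em [□-,◇-] = frameCond⇒quasi-□-◇- em
  frameCond⇒quasi em [◇+,□+] = frameCond⇒quasi-◇+□+
  frameCond⇒quasi em [◇-,□-] = frameCond⇒quasi-◇-□-

  module _ (em : ExcludedMiddle 0ℓ) where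

    by-contradiction : {P : Set} → ¬ ¬ P → P
    by-contradiction = em⇒dne em

    by-cases : {P Q : Set} → (P → Q) → (¬ P → Q) → Q
    by-cases {P} f g = [ f , g ]′ (toSum (em {P}))

    quasi⇒frameCond-□+□- : ∀ p q → Quasi [□+,□-] p q → FrameCond F [□+,□-] p q
    quasi⇒frameCond-□+□- p q quasi u v uRv = by-contradiction λ ¬cond →
      quasi A (∁↓ v) A u
        ( (λ x uR-x ¬uR-x → ¬uR-x uR-x)
        , λ x uRx → by-cases
            (λ x≤v → inj₁ λ uR-x → ¬cond (x , (uRx , uR-x) , x≤v)) inj₂)
        v uRv ≤-refl
      where
      A : Upset
      A = nonSuccessorUpset {R □- q} (□--antimonoʳ q) u

    quasi⇒frameCond-□-□+ : ∀ p q → Quasi [□-,□+] p q → FrameCond F [□-,□+] p q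
    quasi⇒frameCond-□-□+ p q quasi u v uRv = by-contradiction λ ¬cond →
      quasi A (↑ v) A u
        ( (λ _ uR+x → uR+x)
        , λ { x uRx (uR+x , v≤x) → ¬cond (x , (uRx , uR+x) , v≤x) })
        v uRv ≤-refl
      where
      A : Upset
      A = successorUpset {R □+ q} (□+-monoʳ q) u

    quasi⇒frameCond-◇+◇- : ∀ p q → Quasi [◇+,◇-] p q → FrameCond F [◇+,◇-] p q
    quasi⇒frameCond-◇+◇- p q quasi u v uRv = by-contradiction λ ¬cond →
      [ (λ { (x , (uR-x , v≤x) , uRx) → ¬cond (x , (uRx , uR-x) , v≤x) })
      , (λ { (x , ¬uR-x , uR-x) → ¬uR-x uR-x }) ]′
        (quasi A (↑ v) A u (v , ≤-refl , uRv))
      where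
      A : Upset
      A = successorUpset {R ◇- q} (◇--monoʳ q) u

    quasi⇒frameCond-◇-◇+ : ∀ p q → Quasi [◇-,◇+] p q → FrameCond F [◇-,◇+] p q
    quasi⇒frameCond-◇-◇+ p q quasi u v uRv = by-contradiction λ ¬cond →
      [ (λ { (x , ¬A∪∁↓v , uRx) →
             ¬A∪∁↓v (inj₁ λ uR+x →
               ¬A∪∁↓v (inj₂ λ x≤v → ¬cond (x , (uRx , uR+x) , x≤v))) })
      , (λ { (x , ¬uR+x , uR+x) → ¬uR+x uR+x }) ]′
        (quasi A (∁↓ v) A u (v , ∉∁↓-self , uRv))
      where
      A : Upset
      A = nonSuccessorUpset {R ◇+ q} (◇+-antimonoʳ q) u

    quasi⇒frameCond-□+◇- : ∀ p q → Quasi [□+,◇-] p q → FrameCond F [□+,◇-] p q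
    quasi⇒frameCond-□+◇- p q quasi u v uRv = by-contradiction λ ¬cond →
      quasi (∁↓ v) (∁↓ v) (↑ u)
        (λ { w ((x , ¬¬x≤v , wR-x) , u≤w) y wRy y≤v →
             ¬¬x≤v λ x≤v → ¬cond (w , u≤w , □+-monoʳ p wRy y≤v , ◇--monoʳ q wR-x x≤v) })
        u ≤-refl v uRv ≤-refl

    quasi⇒frameCond-□-◇+ : ∀ p q → Quasi [□-,◇+] p q → FrameCond F [□-,◇+] p q
    quasi⇒frameCond-□-◇+ p q quasi u v uRv = by-contradiction λ ¬cond →
      quasi (↑ v) (↑ v) (↑ u)
        (λ { w ((x , v≤x , wR+x) , u≤w) y wRy v≤y →
             ¬cond (w , u≤w , □--antimonoʳ p wRy v≤y , ◇+-antimonoʳ q wR+x v≤x) })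
        u ≤-refl v uRv ≤-refl

    quasi⇒frameCond-◇+□- : ∀ p q → Quasi [◇+,□-] p q → FrameCond F [◇+,□-] p q
    quasi⇒frameCond-◇+□- p q quasi u v uRv = by-contradiction λ ¬cond →
      quasi (↑ v) (↑ v) (∁↓ u)
        (λ { x (y , v≤y , xRy) → by-cases
             (λ x≤u → inj₁ λ z xR-z v≤z →
               ¬cond (x , x≤u , ◇+-antimonoʳ p xRy v≤y , □--antimonoʳ q xR-z v≤z))
             inj₂ })
        u (v , ≤-refl , uRv) ≤-refl

    quasi⇒frameCond-◇-□+ : ∀ p q → Quasi [◇-,□+] p q → FrameCond F [◇-,□+] p q
    quasi⇒frameCond-◇-□+ p q quasi u v uRv = by-contradiction λ ¬cond →
      quasi (∁↓ v) (∁↓ v) (∁↓ u)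
        (λ { x (y , ¬¬y≤v , xRy) → by-cases
             (λ x≤u → inj₁ λ z xR+z z≤v → ¬¬y≤v λ y≤v →
               ¬cond (x , x≤u , ◇--monoʳ p xRy y≤v , □+-monoʳ q xR+z z≤v))
             inj₂ })
        u (v , ∉∁↓-self , uRv) ≤-refl

    quasi⇒frameCond-□+◇+ : ∀ p q → Quasi [□+,◇+] p q → FrameCond F [□+,◇+] p q
    quasi⇒frameCond-□+◇+ p q quasi u v uRv = by-contradiction λ ¬cond →
      quasi (∁↓ v) B (↑ u)
        (λ { w ((y , By , wR+y) , u≤w) z wRz z≤v → By w u≤w (□+-monoʳ p wRz z≤v) wR+y })
        u ( (λ x uRx → by-cases
              (λ x≤v → inj₂ λ w u≤w wRv wR+x →
                 ¬cond (w , x , u≤w , x≤v , wRv , uRx , wR+x))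
              inj₁)
          , ≤-refl)
        v uRv ≤-refl
      where
      B : Upset
      B = upset (λ x → ∀ w → u ≤ w → R □+ p w v → ¬ R ◇+ q w x)
                (λ x≤y Bx w u≤w wRv wR+y → Bx w u≤w wRv (◇+-antimonoʳ q wR+y x≤y))

    quasi⇒frameCond-□-◇- : ∀ p q → Quasi [□-,◇-] p q → FrameCond F [□-,◇-] p q
    quasi⇒frameCond-□-◇- p q quasi u v uRv = by-contradiction λ ¬cond →
      quasi (↑ v) B (↑ u)
        (λ { w ((y , ¬By , wR-y) , u≤w) z wRz v≤z →
             ¬By (w , u≤w , □--antimonoʳ p wRz v≤z , wR-y) })
        u ( (λ { x uRx (v≤x , (w , u≤w , wRv , wR-x)) →
                 ¬cond (w , x , u≤w , v≤x , wRv , uRx , wR-x) })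
          , ≤-refl)
        v uRv ≤-refl
      where
      B : Upset
      B = upset (λ x → ∃[ w ] (u ≤ w × R □- p w v × R ◇- q w x))
                (λ { x≤y (w , u≤w , wRv , wR-x) → w , u≤w , wRv , ◇--monoʳ q wR-x x≤y })

    quasi⇒frameCond-◇+□+ : ∀ p q → Quasi [◇+,□+] p q → FrameCond F [◇+,□+] p q
    quasi⇒frameCond-◇+□+ p q quasi u v uRv = by-contradiction λ ¬cond →
      [ (λ { (y , (v≤y , (x , x≤u , xRv , xR+y)) , uRy) →
             ¬cond (x , y , x≤u , v≤y , xRv , uRy , xR+y) })
      , ∉∁↓-self ]′
        (quasi (↑ v) B (∁↓ u)
          (λ { x (y , v≤y , xRy) → by-cases
               (λ x≤u → inj₁ λ z xR+z → x , x≤u , ◇+-antimonoʳ p xRy v≤y , xR+z)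
               inj₂ })
          u (v , ≤-refl , uRv))
      where
      B : Upset
      B = upset (λ y → ∃[ x ] (x ≤ u × R ◇+ p x v × R □+ q x y))
                (λ { y≤z (x , x≤u , xRv , xR+y) → x , x≤u , xRv , □+-monoʳ q xR+y y≤z })

    quasi⇒frameCond-◇-□- : ∀ p q → Quasi [◇-,□-] p q → FrameCond F [◇-,□-] p q
    quasi⇒frameCond-◇-□- p q quasi u v uRv = by-contradiction λ ¬cond →
      [ (λ { (y , ¬∁↓v∪B , uRy) →
             ¬∁↓v∪B (inj₁ λ y≤v → ¬∁↓v∪B (inj₂ λ { (x , x≤u , xRv , xR-y) →
               ¬cond (x , y , x≤u , y≤v , xRv , uRy , xR-y) })) })
      , ∉∁↓-self ]′
        (quasi (∁↓ v) B (∁↓ u)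
          (λ { x (y , ¬¬y≤v , xRy) → by-cases
               (λ x≤u → inj₁ λ z xR-z Bz → ¬¬y≤v λ y≤v →
                 Bz (x , x≤u , ◇--monoʳ p xRy y≤v , xR-z))
               inj₂ })
          u (v , ∉∁↓-self , uRv))
      where
      B : Upset
      B = upset (λ y → ¬ (∃[ x ] (x ≤ u × R ◇- p x v × R □- q x y)))
                (λ { y≤z ¬By (x , x≤u , xRv , xR-z) →
                     ¬By (x , x≤u , xRv , □--antimonoʳ q xR-z y≤z) })

    quasi⇒frameCond : ∀ π p q → Quasi π p q → FrameCond F π p q
    quasi⇒frameCond [□+,□-] = quasi⇒frameCond-□+□-
    quasi⇒frameCond [□-,□+] = quasi⇒frameCond-□-□+
    quasi⇒frameCond [◇+,◇-] = quasi⇒frameCond-◇+◇-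
    quasi⇒frameCond [◇-,◇+] = quasi⇒frameCond-◇-◇+
    quasi⇒frameCond [□+,◇-] = quasi⇒frameCond-□+◇-
    quasi⇒frameCond [□-,◇+] = quasi⇒frameCond-□-◇+
    quasi⇒frameCond [◇+,□-] = quasi⇒frameCond-◇+□-
    quasi⇒frameCond [◇-,□+] = quasi⇒frameCond-◇-□+
    quasi⇒frameCond [□+,◇+] = quasi⇒frameCond-□+◇+
    quasi⇒frameCond [□-,◇-] = quasi⇒frameCond-□-◇-
    quasi⇒frameCond [◇+,□+] = quasi⇒frameCond-◇+□+
    quasi⇒frameCond [◇-,□-] = quasi⇒frameCond-◇-□-

mainTheorem2 : ExcludedMiddle 0ℓ →
    (𝓛 : Signature) (π : Pair) (pΔ : first π ∈ˢ 𝓛) (p∇ : second π ∈ˢ 𝓛)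
    (F : Frame 𝓛) →
    FrameCond F π pΔ p∇ ⇔ ComplexAlgebra.Quasi F π pΔ p∇
mainTheorem2 em _ π p q F =
  mk⇔ (frameCond⇒quasi F em π p q) (quasi⇒frameCond F em π p q)
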